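{- Let $k\ge 1$ be an integer. For integers $0\le j\le K$ define $$\left\langle \begin{matrix} K \\ j \end{matrix} \right\rangle (x, s, q) = \frac{\prod_{i=1}^{K} f(i, x, s)}{\prod_{i=1}^j f(i, x, q^{j-i}s)\, \prod_{i=1}^{K-j} f(i, x, q^{j} s)}.$$ Then for all $n\in\mathbb{Z}$, $$\sum_{j=0}^{k+1} (-1)^{\binom{j+1}{2}}\, s^{\binom{j}{2}}\, q^{\frac{j(j-1)(2j-1)}{6}} \left\langle \begin{matrix} k+1 \\ j \end{matrix} \right\rangle (x, s, q)\, f(n-j, x, q^j s)^k = 0.$$
   Context: Let $q,x,s$ be indeterminates. The Carlitz $q$-Fibonacci polynomials $f(n,x,s)$, $n\in\mathbb{Z}$, are the elements of the field $\mathbb{Q}(q,x,s)$ determined by $f(0,x,s)=0$, $f(1,x,s)=1$ and $f(n, x, s) = x f(n-1, x, s) + q^{n-2}s f(n-2, x, s)$ for all $n\in\mathbb{Z}$ (the recurrence is used in both directions to define $f$ for negative $n$). Expressions such as $f(m,x,q^a s)$ mean $f(m,x,t)$ with the third argument $t$ replaced by $q^a s$. -}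

module Defs where

open import Level using (Level; suc; _⊔_)
open import Algebra.Bundles using (CommutativeRing)
open import Data.Nat as ℕ using (ℕ; zero; _∸_; _/_)
open import Data.Integer as ℤ using (ℤ; +_; -[1+_])
open import Data.Product using (_×_; _,_; proj₁)
open import Relation.Nullary using (¬_)

-- The inverse is given as a total operation
-- whose value at 0 is irrelevant (only the law for nonzero a is imposed).
record Field (c ℓ : Level) : Set (Level.suc (c ⊔ ℓ)) where
  field
    commutativeRing : CommutativeRing c ℓ
  open CommutativeRing commutativeRing public
  field
    _⁻¹      : Carrier → Carrier
    inverseʳ : ∀ a → ¬ (a ≈ 0#) → (a * (a ⁻¹)) ≈ 1#
    0≉1      : ¬ (0# ≈ 1#)

module FieldDefs {c ℓ : Level} (F : Field c ℓ) where
  open Field F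

  pow : Carrier → ℕ → Carrier
  pow a zero       = 1#
  pow a (ℕ.suc m)  = a * pow a m

  powℤ : Carrier → ℤ → Carrier
  powℤ a (+ m)      = pow a m
  powℤ a -[1+ m ]   = (pow a (ℕ.suc m)) ⁻¹

  module _ (q x : Carrier) where
    -- forward:  fpos t m = (f(m,x,t), f(m+1,x,t))
    fpos : Carrier → ℕ → Carrier × Carrier
    fpos t zero = 0# , 1#
    fpos t (ℕ.suc m) with fpos t m
    ... | a , b = b , ((x * b) + ((pow q m * t) * a))

    -- backward: fneg t m = (f(-m,x,t), f(-m+1,x,t)), using
    -- f(n-2) = (f(n) - x f(n-1)) / (q^(n-2) t)  with n = 1 - m
    fneg : Carrier → ℕ → Carrier × Carrier
    fneg t zero = 0# , 1#
    fneg t (ℕ.suc m) with fneg t m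
    ... | a , b = ((b - (x * a)) * ((powℤ q -[1+ m ] * t) ⁻¹)) , a

    fib : ℤ → Carrier → Carrier
    fib (+ m)      t = proj₁ (fpos t m)
    fib -[1+ m ]   t = proj₁ (fneg t (ℕ.suc m))

    prod : ℕ → (ℕ → Carrier) → Carrier
    prod zero      g = 1#
    prod (ℕ.suc m) g = prod m g * g (ℕ.suc m)

    sumTo : ℕ → (ℕ → Carrier) → Carrier
    sumTo zero      g = g 0
    sumTo (ℕ.suc m) g = sumTo m g + g (ℕ.suc m)

    module _ (s : Carrier) where
      num : ℕ → Carrier
      num K = prod K (λ i → fib (+ i) s)

      den : ℕ → ℕ → Carrier
      den K j = prod j (λ i → fib (+ i) (pow q (j ∸ i) * s))
              * prod (K ∸ j) (λ i → fib (+ i) (pow q j * s))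

      bracket : ℕ → ℕ → Carrier
      bracket K j = num K * (den K j ⁻¹)

      choose2 : ℕ → ℕ
      choose2 m = (m ℕ.* (m ∸ 1)) / 2

      term : ℕ → ℤ → ℕ → Carrier
      term k n j =
        pow (- 1#) (choose2 (ℕ.suc j))
        * pow s (choose2 j)
        * pow q ((j ℕ.* (j ∸ 1) ℕ.* ((2 ℕ.* j) ∸ 1)) / 6)
        * bracket (ℕ.suc k) j
        * pow (fib (n ℤ.- (+ j)) (pow q j * s)) k

      lhs : ℕ → ℤ → Carrier
      lhs k n = sumTo (ℕ.suc k) (term k n)

-- For fixed s, each of the functions n ↦ f(n - j, x, q^j s) satisfies the same recurrence
-- h(n+2) = x h(n+1) + q^n s h(n) as f(n, x, s), so every linear combination of products of them
-- taken in its first argument does too. Replacing the k-th power by a product over k independent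
-- arguments n₁ … n_k turns the sum into a form T_k(s; n₁, …, n_k) that is, in n₁, a solution of the
-- recurrence; since f(k+1, x, s) ≠ 0, such a solution vanishes once it vanishes at n₁ = 0 and at
-- n₁ = k+1. At n₁ = k+1 the last summand dies and the others reduce to f(k+1, x, s) T_{k-1}(s; …);
-- at n₁ = 0 the first summand dies and, by the Casoratian of f(·, x, s) and f(· - j, x, q^j s),
-- the others reduce to a multiple of T_{k-1}(qs; n₂ - 1, …). Induction on k concludes.
module Submission where

open import Defs
open import Level using (Level)
open import Data.Nat using (ℕ; suc; _≤_)
open import Data.Integer using (ℤ)
open import Relation.Nullary using (¬_)

open import Algebra.Bundles using (CommutativeRing)
open import Data.Nat as ℕ using (zero; z≤n; s≤s; _∸_)
import Data.Nat.Properties as ℕP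
open import Data.Integer as ℤ using (+_; -[1+_]; _◃_; _⊖_; ∣_∣; sign)
import Data.Integer.Properties as ℤP
open import Data.Sign as Sign using (Sign)
open import Data.Maybe using (Maybe; just; nothing)
open import Data.Sum using (inj₁; inj₂)
open import Data.Product as Prod using (_,_; proj₁; proj₂)
open import Data.Vec as Vec using (Vec; []; _∷_)
open import Relation.Nullary using (yes; no)
open import Relation.Binary.PropositionalEquality as ≡ using (_≡_)

-- Algebra.Solver.Ring instantiated with integer coefficients, which lets it prove
-- identities involving negation in an arbitrary commutative ring.
module ℤ-CoefficientRingSolver {c ℓ : Level} (R : CommutativeRing c ℓ) where
  open CommutativeRing R
  open import Algebra.Properties.Ring ring using (-‿distribˡ-*; -‿distribʳ-*; -‿involutive; -0#≈0#; -‿+-comm)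
  open import Algebra.Properties.CommutativeSemigroup +-commutativeSemigroup using (interchange)
  open import Algebra.Properties.Semiring.Mult.TCOptimised semiring using (_×_; ×-homo-+; ×1-homo-*; ×-cong)
  open import Relation.Binary.Reasoning.Setoid setoid
  import Algebra.Solver.Ring.AlmostCommutativeRing as ACR

  ⟦_⟧ℤ : ℤ → Carrier
  ⟦ + n ⟧ℤ      = n × 1#
  ⟦ -[1+ n ] ⟧ℤ = - (suc n × 1#)

  signed : Sign → Carrier → Carrier
  signed Sign.+ a = a
  signed Sign.- a = - a

  signed-cong : ∀ σ {a b} → a ≈ b → signed σ a ≈ signed σ b
  signed-cong Sign.+ a≈b = a≈b
  signed-cong Sign.- a≈b = -‿cong a≈b

  signed-* : ∀ σ τ a b → signed (σ Sign.* τ) (a * b) ≈ signed σ a * signed τ b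
  signed-* Sign.+ Sign.+ a b = refl
  signed-* Sign.+ Sign.- a b = -‿distribʳ-* a b
  signed-* Sign.- Sign.+ a b = -‿distribˡ-* a b
  signed-* Sign.- Sign.- a b = begin
    a * b         ≈⟨ *-cong (-‿involutive a) refl ⟨
    - - a * b     ≈⟨ -‿distribˡ-* (- a) b ⟨
    - (- a * b)   ≈⟨ -‿distribʳ-* (- a) b ⟩
    - a * - b     ∎

  ⟦◃⟧ : ∀ σ n → ⟦ σ ◃ n ⟧ℤ ≈ signed σ (n × 1#)
  ⟦◃⟧ Sign.+ zero    = refl
  ⟦◃⟧ Sign.- zero    = sym -0#≈0#
  ⟦◃⟧ Sign.+ (suc n) = refl
  ⟦◃⟧ Sign.- (suc n) = refl

  ⟦⟧-sign-abs : ∀ i → ⟦ i ⟧ℤ ≈ signed (sign i) (∣ i ∣ × 1#)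
  ⟦⟧-sign-abs (+ zero)  = refl
  ⟦⟧-sign-abs (+ suc n) = refl
  ⟦⟧-sign-abs -[1+ n ]  = refl

  *-homo : ∀ i j → ⟦ i ℤ.* j ⟧ℤ ≈ ⟦ i ⟧ℤ * ⟦ j ⟧ℤ
  *-homo i j = begin
    ⟦ i ℤ.* j ⟧ℤ                                                ≈⟨ ⟦◃⟧ (sign i Sign.* sign j) (∣ i ∣ ℕ.* ∣ j ∣) ⟩
    signed (sign i Sign.* sign j) ((∣ i ∣ ℕ.* ∣ j ∣) × 1#)      ≈⟨ signed-cong (sign i Sign.* sign j) (×1-homo-* ∣ i ∣ ∣ j ∣) ⟩
    signed (sign i Sign.* sign j) ((∣ i ∣ × 1#) * (∣ j ∣ × 1#)) ≈⟨ signed-* (sign i) (sign j) _ _ ⟩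
    signed (sign i) (∣ i ∣ × 1#) * signed (sign j) (∣ j ∣ × 1#) ≈⟨ *-cong (⟦⟧-sign-abs i) (⟦⟧-sign-abs j) ⟨
    ⟦ i ⟧ℤ * ⟦ j ⟧ℤ                                             ∎

  +-‿-shift : ∀ a b d → b + - d ≈ (a + b) + - (a + d)
  +-‿-shift a b d = begin
    b + - d                ≈⟨ +-identityˡ _ ⟨
    0# + (b + - d)         ≈⟨ +-cong (-‿inverseʳ a) refl ⟨
    (a + - a) + (b + - d)  ≈⟨ interchange a (- a) b (- d) ⟩
    (a + b) + (- a + - d)  ≈⟨ +-cong refl (-‿+-comm a d) ⟩
    (a + b) + - (a + d)    ∎

  ⊖-homo : ∀ m n → ⟦ m ⊖ n ⟧ℤ ≈ (m × 1#) + - (n × 1#)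
  ⊖-homo zero    zero    = sym (trans (+-identityˡ _) -0#≈0#)
  ⊖-homo zero    (suc n) = sym (+-identityˡ _)
  ⊖-homo (suc m) zero    = sym (trans (+-cong refl -0#≈0#) (+-identityʳ _))
  ⊖-homo (suc m) (suc n) = begin
    ⟦ suc m ⊖ suc n ⟧ℤ                ≡⟨ ≡.cong ⟦_⟧ℤ (ℤP.[1+m]⊖[1+n]≡m⊖n m n) ⟩
    ⟦ m ⊖ n ⟧ℤ                        ≈⟨ ⊖-homo m n ⟩
    (m × 1#) + - (n × 1#)             ≈⟨ +-‿-shift 1# _ _ ⟩
    (1# + m × 1#) + - (1# + n × 1#)   ≈⟨ +-cong (×-homo-+ 1# 1 m) (-‿cong (×-homo-+ 1# 1 n)) ⟨
    (suc m × 1#) + - (suc n × 1#)     ∎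

  +-homo : ∀ i j → ⟦ i ℤ.+ j ⟧ℤ ≈ ⟦ i ⟧ℤ + ⟦ j ⟧ℤ
  +-homo (+ m)     (+ n)     = ×-homo-+ 1# m n
  +-homo (+ m)     -[1+ n ]  = ⊖-homo m (suc n)
  +-homo -[1+ m ]  (+ n)     = trans (⊖-homo n (suc m)) (+-comm _ _)
  +-homo -[1+ m ]  -[1+ n ]  = begin
    - (suc (suc (m ℕ.+ n)) × 1#)      ≈⟨ -‿cong (×-cong (≡.sym (ℕP.+-suc (suc m) n)) refl) ⟩
    - ((suc m ℕ.+ suc n) × 1#)        ≈⟨ -‿cong (×-homo-+ 1# (suc m) (suc n)) ⟩
    - ((suc m × 1#) + (suc n × 1#))   ≈⟨ -‿+-comm _ _ ⟨
    - (suc m × 1#) + - (suc n × 1#)   ∎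

  -‿homo : ∀ i → ⟦ ℤ.- i ⟧ℤ ≈ - ⟦ i ⟧ℤ
  -‿homo (+ zero)  = sym -0#≈0#
  -‿homo (+ suc n) = refl
  -‿homo -[1+ n ]  = sym (-‿involutive _)

  homomorphism : ℤ.+-*-rawRing ACR.-Raw-AlmostCommutative⟶ ACR.fromCommutativeRing R
  homomorphism = record
    { ⟦_⟧ = ⟦_⟧ℤ ; +-homo = +-homo ; *-homo = *-homo ; -‿homo = -‿homo
    ; 0-homo = refl ; 1-homo = refl }

  ⟦⟧-equal? : ∀ i j → Maybe (⟦ i ⟧ℤ ≈ ⟦ j ⟧ℤ)
  ⟦⟧-equal? i j with i ℤP.≟ j
  ... | yes ≡.refl = just refl
  ... | no _       = nothing

  open import Algebra.Solver.Ring ℤ.+-*-rawRing (ACR.fromCommutativeRing R) homomorphism ⟦⟧-equal? public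

module Exponents where
  open import Data.Nat.Solver using (module +-*-Solver)
  open +-*-Solver
  open import Data.Nat.DivMod using (m*n/n≡m)
  open import Data.Nat using (_+_; _*_; _/_)

  triangular : ℕ → ℕ
  triangular zero    = 0
  triangular (suc m) = triangular m + m

  sumOfSquares : ℕ → ℕ
  sumOfSquares zero    = 0
  sumOfSquares (suc m) = sumOfSquares m + m * m

  m*[m∸1]≡triangular*2 : ∀ m → m * (m ∸ 1) ≡ triangular m * 2
  m*[m∸1]≡triangular*2 zero          = ≡.refl
  m*[m∸1]≡triangular*2 (suc zero)    = ≡.refl
  m*[m∸1]≡triangular*2 (suc (suc m)) = ≡.trans (step m)
    (≡.trans (≡.cong (_+ suc m * 2) (m*[m∸1]≡triangular*2 (suc m)))
             (≡.sym (ℕP.*-distribʳ-+ 2 (triangular (suc m)) (suc m))))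
    where
    step : ∀ m → suc (suc m) * suc m ≡ suc m * m + suc m * 2
    step = solve 1 (λ m → (con 2 :+ m) :* (con 1 :+ m) := (con 1 :+ m) :* m :+ (con 1 :+ m) :* con 2) ≡.refl

  pyramidal≡sumOfSquares*6 : ∀ m → m * (m ∸ 1) * (2 * m ∸ 1) ≡ sumOfSquares m * 6
  pyramidal≡sumOfSquares*6 zero          = ≡.refl
  pyramidal≡sumOfSquares*6 (suc zero)    = ≡.refl
  pyramidal≡sumOfSquares*6 (suc (suc m)) = ≡.trans (step m)
    (≡.trans (≡.cong (_+ suc m * suc m * 6) (pyramidal≡sumOfSquares*6 (suc m)))
             (≡.sym (ℕP.*-distribʳ-+ 6 (sumOfSquares (suc m)) (suc m * suc m))))
    where
    step : ∀ m → suc (suc m) * suc m * (2 * suc (suc m) ∸ 1)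
               ≡ suc m * m * (2 * suc m ∸ 1) + suc m * suc m * 6
    step = solve 1 (λ m → (con 2 :+ m) :* (con 1 :+ m) :* (con 1 :+ (m :+ (con 2 :+ (m :+ con 0))))
      := (con 1 :+ m) :* m :* (m :+ (con 1 :+ (m :+ con 0))) :+ (con 1 :+ m) :* (con 1 :+ m) :* con 6) ≡.refl

  m*[m∸1]/2≡triangular : ∀ m → (m * (m ∸ 1)) / 2 ≡ triangular m
  m*[m∸1]/2≡triangular m = ≡.trans (≡.cong (_/ 2) (m*[m∸1]≡triangular*2 m)) (m*n/n≡m (triangular m) 2)

  pyramidal/6≡sumOfSquares : ∀ m → (m * (m ∸ 1) * (2 * m ∸ 1)) / 6 ≡ sumOfSquares m
  pyramidal/6≡sumOfSquares m = ≡.trans (≡.cong (_/ 6) (pyramidal≡sumOfSquares*6 m)) (m*n/n≡m (sumOfSquares m) 6)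

  m*m≡triangular+triangular[1+m] : ∀ m → m * m ≡ triangular m + triangular (suc m)
  m*m≡triangular+triangular[1+m] m = begin
    m * m                                     ≡⟨ square m ⟩
    m * (m ∸ 1) + m                           ≡⟨ ≡.cong (_+ m) (m*[m∸1]≡triangular*2 m) ⟩
    triangular m * 2 + m                      ≡⟨ solve 2 (λ t m → t :* con 2 :+ m := t :+ (t :+ m)) ≡.refl (triangular m) m ⟩
    triangular m + (triangular m + m)         ∎
    where
    open ≡.≡-Reasoning
    square : ∀ m → m * m ≡ m * (m ∸ 1) + m
    square zero    = ≡.refl
    square (suc m) = solve 1 (λ m → (con 1 :+ m) :* (con 1 :+ m) := (con 1 :+ m) :* m :+ (con 1 :+ m)) ≡.refl m

open Exponents using (triangular; sumOfSquares; m*[m∸1]/2≡triangular; pyramidal/6≡sumOfSquares; m*m≡triangular+triangular[1+m])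

module FieldProperties {c ℓ : Level} (F : Field c ℓ) where
  open Field F
  open FieldDefs F using (pow)
  open ℤ-CoefficientRingSolver commutativeRing using (solve; _:=_; _:*_)
  open import Relation.Binary.Reasoning.Setoid setoid
  open import Algebra.Properties.Ring ring using (-‿distribˡ-*; -‿involutive; -0#≈0#)

  inverseˡ : ∀ {a} → a ≉ 0# → a ⁻¹ * a ≈ 1#
  inverseˡ {a} a≉0 = trans (*-comm _ _) (inverseʳ a a≉0)

  cancelʳ-zero : ∀ {a b} → b ≉ 0# → a * b ≈ 0# → a ≈ 0#
  cancelʳ-zero {a} {b} b≉0 ab≈0 = begin
    a                ≈⟨ *-identityʳ a ⟨
    a * 1#           ≈⟨ *-cong refl (inverseʳ b b≉0) ⟨
    a * (b * b ⁻¹)   ≈⟨ *-assoc _ _ _ ⟨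
    (a * b) * b ⁻¹   ≈⟨ *-cong ab≈0 refl ⟩
    0# * b ⁻¹        ≈⟨ zeroˡ _ ⟩
    0#               ∎

  cancelˡ-zero : ∀ {a b} → b ≉ 0# → b * a ≈ 0# → a ≈ 0#
  cancelˡ-zero b≉0 ba≈0 = cancelʳ-zero b≉0 (trans (*-comm _ _) ba≈0)

  *-nonzero : ∀ {a b} → a ≉ 0# → b ≉ 0# → a * b ≉ 0#
  *-nonzero a≉0 b≉0 ab≈0 = a≉0 (cancelʳ-zero b≉0 ab≈0)

  1≉0 : 1# ≉ 0#
  1≉0 1≈0 = 0≉1 (sym 1≈0)

  -1≉0 : - 1# ≉ 0#
  -1≉0 -1≈0 = 1≉0 (trans (sym (-‿involutive 1#)) (trans (-‿cong -1≈0) -0#≈0#))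

  ⁻¹-nonzero : ∀ {a} → a ≉ 0# → a ⁻¹ ≉ 0#
  ⁻¹-nonzero {a} a≉0 a⁻¹≈0 = 1≉0 (begin
    1#         ≈⟨ inverseʳ a a≉0 ⟨
    a * a ⁻¹   ≈⟨ *-cong refl a⁻¹≈0 ⟩
    a * 0#     ≈⟨ zeroʳ _ ⟩
    0#         ∎)

  ⁻¹-unique : ∀ {a b} → a ≉ 0# → a * b ≈ 1# → b ≈ a ⁻¹
  ⁻¹-unique {a} {b} a≉0 ab≈1 = begin
    b                ≈⟨ *-identityʳ b ⟨
    b * 1#           ≈⟨ *-cong refl (inverseʳ a a≉0) ⟨
    b * (a * a ⁻¹)   ≈⟨ solve 3 (λ b a a' → b :* (a :* a') := (a :* b) :* a') refl b a (a ⁻¹) ⟩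
    (a * b) * a ⁻¹   ≈⟨ *-cong ab≈1 refl ⟩
    1# * a ⁻¹        ≈⟨ *-identityˡ _ ⟩
    a ⁻¹             ∎

  ⁻¹-cong : ∀ {a b} → a ≉ 0# → a ≈ b → a ⁻¹ ≈ b ⁻¹
  ⁻¹-cong a≉0 a≈b = ⁻¹-unique (λ b≈0 → a≉0 (trans a≈b b≈0)) (trans (*-cong (sym a≈b) refl) (inverseʳ _ a≉0))

  ⁻¹-distrib-* : ∀ {a b} → a ≉ 0# → b ≉ 0# → (a * b) ⁻¹ ≈ a ⁻¹ * b ⁻¹
  ⁻¹-distrib-* {a} {b} a≉0 b≉0 = sym (⁻¹-unique (*-nonzero a≉0 b≉0) (begin
    (a * b) * (a ⁻¹ * b ⁻¹)   ≈⟨ solve 4 (λ a b a' b' → (a :* b) :* (a' :* b') := (a :* a') :* (b :* b')) refl a b (a ⁻¹) (b ⁻¹) ⟩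
    (a * a ⁻¹) * (b * b ⁻¹)   ≈⟨ *-cong (inverseʳ a a≉0) (inverseʳ b b≉0) ⟩
    1# * 1#                   ≈⟨ *-identityˡ _ ⟩
    1#                        ∎))

  *-cancelʳ : ∀ {a b m} → m ≉ 0# → a * m ≈ b * m → a ≈ b
  *-cancelʳ {a} {b} {m} m≉0 am≈bm = begin
    a                        ≈⟨ +-identityʳ a ⟨
    a + 0#                   ≈⟨ +-cong refl (-‿inverseˡ b) ⟨
    a + (- b + b)            ≈⟨ +-assoc _ _ _ ⟨
    (a + - b) + b            ≈⟨ +-cong (cancelʳ-zero m≉0 (trans (distribʳ m a (- b))
                                   (trans (+-cong am≈bm (sym (-‿distribˡ-* b m))) (-‿inverseʳ _)))) refl ⟩
    0# + b                   ≈⟨ +-identityˡ b ⟩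
    b                        ∎

  pow-nonzero : ∀ {a} n → a ≉ 0# → pow a n ≉ 0#
  pow-nonzero zero    a≉0 = 1≉0
  pow-nonzero (suc n) a≉0 = *-nonzero a≉0 (pow-nonzero n a≉0)

  pow-+ : ∀ a m n → pow a (m ℕ.+ n) ≈ pow a m * pow a n
  pow-+ a zero    n = sym (*-identityˡ _)
  pow-+ a (suc m) n = trans (*-cong refl (pow-+ a m n)) (sym (*-assoc _ _ _))

  pow-distrib-* : ∀ a b n → pow (a * b) n ≈ pow a n * pow b n
  pow-distrib-* a b zero    = sym (*-identityˡ _)
  pow-distrib-* a b (suc n) = trans (*-cong refl (pow-distrib-* a b n))
    (solve 4 (λ a b c d → (a :* b) :* (c :* d) := (a :* c) :* (b :* d)) refl a b (pow a n) (pow b n))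

  pow-≡ : ∀ a {m n} → m ≡ n → pow a m ≈ pow a n
  pow-≡ a ≡.refl = refl

module CarlitzFibonacci {c ℓ : Level} (F : Field c ℓ) (q x : Field.Carrier F)
                        (q≉0 : ¬ (Field._≈_ F q (Field.0# F))) where
  open Field F
  open FieldDefs F using (pow; powℤ; fib; fpos; fneg; prod; sumTo; num; den; bracket; choose2)
  open FieldProperties F
  open ℤ-CoefficientRingSolver commutativeRing using (solve; _:=_; _:+_; _:*_; :-_; con)
  open import Relation.Binary.Reasoning.Setoid setoid
  open import Algebra.Properties.Ring ring using (-‿distribʳ-*; -0#≈0#)

  f : ℤ → Carrier → Carrier
  f = fib q x

  q^b*s≉0 : ∀ b {s} → s ≉ 0# → pow q b * s ≉ 0#
  q^b*s≉0 b s≉0 = *-nonzero (pow-nonzero b q≉0) s≉0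

  q^[1+b]*s≈q^b*[q*s] : ∀ b s → pow q (suc b) * s ≈ pow q b * (q * s)
  q^[1+b]*s≈q^b*[q*s] b s = solve 3 (λ q p s → (q :* p) :* s := p :* (q :* s)) refl q (pow q b) s

  powℤ-nonzero : ∀ z → powℤ q z ≉ 0#
  powℤ-nonzero (+ n)    = pow-nonzero n q≉0
  powℤ-nonzero -[1+ n ] = ⁻¹-nonzero (pow-nonzero (suc n) q≉0)

  powℤ-pred : ∀ z → powℤ q (ℤ.pred z) * q ≈ powℤ q z
  powℤ-pred (+ zero)  = trans (*-cong refl (sym (*-identityʳ q))) (inverseˡ (pow-nonzero 1 q≉0))
  powℤ-pred (+ suc n) = *-comm _ _
  powℤ-pred -[1+ n ]  = ⁻¹-unique (pow-nonzero (suc n) q≉0) (begin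
    pow q (suc n) * (pow q (suc (suc n)) ⁻¹ * q)
      ≈⟨ solve 3 (λ a b q → a :* (b :* q) := (q :* a) :* b) refl (pow q (suc n)) (pow q (suc (suc n)) ⁻¹) q ⟩
    pow q (suc (suc n)) * pow q (suc (suc n)) ⁻¹
      ≈⟨ inverseʳ _ (pow-nonzero (suc (suc n)) q≉0) ⟩
    1# ∎)

  powℤ-minus : ∀ m j → powℤ q (m ℤ.- + j) * pow q j ≈ powℤ q m
  powℤ-minus m zero    = trans (*-identityʳ _) (reflexive (≡.cong (powℤ q) (ℤP.+-identityʳ m)))
  powℤ-minus m (suc j) = begin
    powℤ q (m ℤ.- + suc j) * (q * pow q j)            ≡⟨ ≡.cong (λ z → powℤ q z * (q * pow q j)) (ℤP.minus-suc m j) ⟩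
    powℤ q (ℤ.pred (m ℤ.- + j)) * (q * pow q j)       ≈⟨ *-assoc _ _ _ ⟨
    (powℤ q (ℤ.pred (m ℤ.- + j)) * q) * pow q j       ≈⟨ *-cong (powℤ-pred (m ℤ.- + j)) refl ⟩
    powℤ q (m ℤ.- + j) * pow q j                      ≈⟨ powℤ-minus m j ⟩
    powℤ q m                                          ∎

  fib-recurrence : ∀ {t} → t ≉ 0# → ∀ m →
    f (ℤ.suc (ℤ.suc m)) t ≈ x * f (ℤ.suc m) t + (powℤ q m * t) * f m t
  fib-recurrence t≉0 (+ k)          = refl
  fib-recurrence {t} t≉0 -[1+ k ] = begin
    f (ℤ.suc (ℤ.suc -[1+ k ])) t        ≡⟨ second k ⟩
    b                                   ≈⟨ solve 3 (λ a b x → b := x :* a :+ con (+ 1) :* (b :+ :- (x :* a))) refl a b x ⟩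
    x * a + 1# * (b - x * a)            ≈⟨ +-cong refl (*-cong (inverseʳ Q Q≉0) refl) ⟨
    x * a + (Q * Q ⁻¹) * (b - x * a)    ≈⟨ +-cong refl (solve 3 (λ Q Q' d → (Q :* Q') :* d := Q :* (d :* Q')) refl Q (Q ⁻¹) (b - x * a)) ⟩
    x * a + Q * ((b - x * a) * Q ⁻¹)    ≡⟨ ≡.cong (λ u → x * u + Q * ((b - x * a) * Q ⁻¹)) (≡.sym (first k)) ⟩
    x * f (ℤ.suc -[1+ k ]) t + Q * f -[1+ k ] t ∎
    where
    first : ∀ k → f (ℤ.suc -[1+ k ]) t ≡ proj₁ (fneg q x t k)
    first zero    = ≡.refl
    first (suc k) = ≡.refl
    second : ∀ k → f (ℤ.suc (ℤ.suc -[1+ k ])) t ≡ proj₂ (fneg q x t k)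
    second zero    = ≡.refl
    second (suc k) = first k
    a = proj₁ (fneg q x t k)
    b = proj₂ (fneg q x t k)
    Q = powℤ q -[1+ k ] * t
    Q≉0 : Q ≉ 0#
    Q≉0 = *-nonzero (powℤ-nonzero -[1+ k ]) t≉0

  fib-cong : ∀ {t t'} → t ≉ 0# → t ≈ t' → ∀ n → f n t ≈ f n t'
  fib-cong {t} {t'} t≉0 t≈t' (+ m)    = proj₁ (forward m)
    where
    forward : ∀ m → proj₁ (fpos q x t m) ≈ proj₁ (fpos q x t' m) Prod.× proj₂ (fpos q x t m) ≈ proj₂ (fpos q x t' m)
    forward zero = refl , refl
    forward (suc m) with forward m
    ... | a≈a' , b≈b' = b≈b' , +-cong (*-cong refl b≈b') (*-cong (*-cong refl t≈t') a≈a')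
  fib-cong {t} {t'} t≉0 t≈t' -[1+ m ] = proj₁ (backward (suc m))
    where
    backward : ∀ m → proj₁ (fneg q x t m) ≈ proj₁ (fneg q x t' m) Prod.× proj₂ (fneg q x t m) ≈ proj₂ (fneg q x t' m)
    backward zero = refl , refl
    backward (suc m) with backward m
    ... | a≈a' , b≈b' = *-cong (+-cong b≈b' (-‿cong (*-cong refl a≈a')))
                               (⁻¹-cong (*-nonzero (powℤ-nonzero -[1+ m ]) t≉0) (*-cong refl t≈t')) , a≈a'

  -- Solutions of the Carlitz recurrence

  IsSolution : Carrier → (ℤ → Carrier) → Set ℓ
  IsSolution s h = ∀ m → h (ℤ.suc (ℤ.suc m)) ≈ x * h (ℤ.suc m) + (powℤ q m * s) * h m

  shiftedFib : Carrier → ℕ → ℤ → Carrier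
  shiftedFib s j n = f (n ℤ.- + j) (pow q j * s)

  shiftedFib-self : ∀ s M → shiftedFib s M (+ M) ≈ 0#
  shiftedFib-self s M = reflexive (≡.cong (λ z → f z (pow q M * s)) (ℤP.+-inverseʳ (+ M)))

  fib-isSolution : ∀ {s} → s ≉ 0# → IsSolution s (λ n → f n s)
  fib-isSolution = fib-recurrence

  suc-minus : ∀ m i → ℤ.suc m ℤ.- i ≡ ℤ.suc (m ℤ.- i)
  suc-minus m i = ℤP.+-assoc (+ 1) m (ℤ.- i)

  shiftedFib-isSolution : ∀ {s} → s ≉ 0# → ∀ j → IsSolution s (shiftedFib s j)
  shiftedFib-isSolution {s} s≉0 j m = begin
    f (ℤ.suc (ℤ.suc m) ℤ.- + j) t
      ≡⟨ ≡.cong (λ z → f z t) (≡.trans (suc-minus (ℤ.suc m) (+ j)) (≡.cong ℤ.suc (suc-minus m (+ j)))) ⟩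
    f (ℤ.suc (ℤ.suc (m ℤ.- + j))) t
      ≈⟨ fib-recurrence (q^b*s≉0 j s≉0) (m ℤ.- + j) ⟩
    x * f (ℤ.suc (m ℤ.- + j)) t + (powℤ q (m ℤ.- + j) * t) * f (m ℤ.- + j) t
      ≈⟨ +-cong (*-cong refl (reflexive (≡.cong (λ z → f z t) (≡.sym (suc-minus m (+ j)))))) (*-cong coefficient refl) ⟩
    x * f (ℤ.suc m ℤ.- + j) t + (powℤ q m * s) * f (m ℤ.- + j) t ∎
    where
    t = pow q j * s
    coefficient : powℤ q (m ℤ.- + j) * t ≈ powℤ q m * s
    coefficient = trans (sym (*-assoc _ _ _)) (*-cong (powℤ-minus m j) refl)

  isSolution-*ˡ : ∀ {s h} a → IsSolution s h → IsSolution s (λ m → a * h m)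
  isSolution-*ˡ {s} {h} a sol m = begin
    a * h (ℤ.suc (ℤ.suc m))                          ≈⟨ *-cong refl (sol m) ⟩
    a * (x * h (ℤ.suc m) + (powℤ q m * s) * h m)
      ≈⟨ solve 5 (λ a x r u v → a :* (x :* u :+ r :* v) := x :* (a :* u) :+ r :* (a :* v)) refl a x (powℤ q m * s) (h (ℤ.suc m)) (h m) ⟩
    x * (a * h (ℤ.suc m)) + (powℤ q m * s) * (a * h m) ∎

  isSolution-*ʳ : ∀ {s h} b → IsSolution s h → IsSolution s (λ m → h m * b)
  isSolution-*ʳ {s} {h} b sol m = begin
    h (ℤ.suc (ℤ.suc m)) * b                          ≈⟨ *-cong (sol m) refl ⟩
    (x * h (ℤ.suc m) + (powℤ q m * s) * h m) * b
      ≈⟨ solve 5 (λ b x r u v → (x :* u :+ r :* v) :* b := x :* (u :* b) :+ r :* (v :* b)) refl b x (powℤ q m * s) (h (ℤ.suc m)) (h m) ⟩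
    x * (h (ℤ.suc m) * b) + (powℤ q m * s) * (h m * b) ∎

  isSolution-+ : ∀ {s h u} → IsSolution s h → IsSolution s u → IsSolution s (λ m → h m + u m)
  isSolution-+ {s} {h} {u} solh solu m = begin
    h (ℤ.suc (ℤ.suc m)) + u (ℤ.suc (ℤ.suc m))        ≈⟨ +-cong (solh m) (solu m) ⟩
    (x * h (ℤ.suc m) + r * h m) + (x * u (ℤ.suc m) + r * u m)
      ≈⟨ solve 6 (λ x r a b c d → (x :* a :+ r :* b) :+ (x :* c :+ r :* d) := x :* (a :+ c) :+ r :* (b :+ d)) refl x r (h (ℤ.suc m)) (h m) (u (ℤ.suc m)) (u m) ⟩
    x * (h (ℤ.suc m) + u (ℤ.suc m)) + r * (h m + u m) ∎
    where r = powℤ q m * s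

  isSolution-sub : ∀ {s h u} → IsSolution s h → IsSolution s u → IsSolution s (λ m → h m - u m)
  isSolution-sub {s} {h} {u} solh solu = isSolution-+ solh (λ m → begin
    - u (ℤ.suc (ℤ.suc m))                   ≈⟨ -‿cong (solu m) ⟩
    - (x * u (ℤ.suc m) + r m * u m)
      ≈⟨ solve 4 (λ x r a b → :- (x :* a :+ r :* b) := x :* (:- a) :+ r :* (:- b)) refl x (r m) (u (ℤ.suc m)) (u m) ⟩
    x * - u (ℤ.suc m) + r m * - u m        ∎)
    where r = λ m → powℤ q m * s

  isSolution-sumTo : ∀ {s} N (G : ℕ → ℤ → Carrier) → (∀ j → IsSolution s (G j)) →
    IsSolution s (λ m → sumTo q x N (λ j → G j m))
  isSolution-sumTo zero    G sol = sol 0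
  isSolution-sumTo (suc N) G sol = isSolution-+ (isSolution-sumTo N G sol) (sol (suc N))

  solution≈0-of-initial : ∀ {s h} → s ≉ 0# → IsSolution s h → h (+ 0) ≈ 0# → h (+ 1) ≈ 0# → ∀ n → h n ≈ 0#
  solution≈0-of-initial {s} {h} s≉0 sol h0≈0 h1≈0 n = proj₁ (both n)
    where
    Both : ℤ → Set ℓ
    Both m = h m ≈ 0# Prod.× h (ℤ.suc m) ≈ 0#
    forward : ∀ m → Both m → Both (ℤ.suc m)
    forward m (hm≈0 , hm+1≈0) = hm+1≈0 , (begin
      h (ℤ.suc (ℤ.suc m))                         ≈⟨ sol m ⟩
      x * h (ℤ.suc m) + (powℤ q m * s) * h m      ≈⟨ +-cong (*-cong refl hm+1≈0) (*-cong refl hm≈0) ⟩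
      x * 0# + (powℤ q m * s) * 0#                ≈⟨ +-cong (zeroʳ _) (zeroʳ _) ⟩
      0# + 0#                                     ≈⟨ +-identityʳ _ ⟩
      0#                                          ∎)
    backward : ∀ m → Both (ℤ.suc m) → Both m
    backward m (hm+1≈0 , hm+2≈0) = cancelˡ-zero (*-nonzero (powℤ-nonzero m) s≉0) (begin
      (powℤ q m * s) * h m                        ≈⟨ +-identityˡ _ ⟨
      0# + (powℤ q m * s) * h m                   ≈⟨ +-cong (trans (*-cong refl hm+1≈0) (zeroʳ x)) refl ⟨
      x * h (ℤ.suc m) + (powℤ q m * s) * h m      ≈⟨ sol m ⟨
      h (ℤ.suc (ℤ.suc m))                         ≈⟨ hm+2≈0 ⟩
      0#                                          ∎) , hm+1≈0
    both : ∀ m → Both m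
    both (+ zero)         = h0≈0 , h1≈0
    both (+ suc k)        = forward (+ k) (both (+ k))
    both -[1+ zero ]      = backward -[1+ 0 ] (both (+ 0))
    both -[1+ suc k ]     = backward -[1+ suc k ] (both -[1+ k ])

  -- A solution vanishing at 0 is a multiple of f(·, x, s).
  solution≈0-of-boundary : ∀ {s h} → s ≉ 0# → IsSolution s h → h (+ 0) ≈ 0# →
    ∀ M → h (+ M) ≈ 0# → f (+ M) s ≉ 0# → ∀ n → h n ≈ 0#
  solution≈0-of-boundary {s} {h} s≉0 sol h0≈0 M hM≈0 fM≉0 n = begin
    h n                    ≈⟨ solve 2 (λ a b → a := (a :+ :- b) :+ b) refl (h n) (h₁ * f n s) ⟩
    d n + h₁ * f n s       ≈⟨ +-cong (d≈0 n) (trans (*-cong h₁≈0 refl) (zeroˡ _)) ⟩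
    0# + 0#                ≈⟨ +-identityʳ _ ⟩
    0#                     ∎
    where
    h₁ = h (+ 1)
    d : ℤ → Carrier
    d m = h m - h₁ * f m s
    d≈0 : ∀ m → d m ≈ 0#
    d≈0 = solution≈0-of-initial s≉0 (isSolution-sub sol (isSolution-*ˡ h₁ (fib-isSolution s≉0)))
      (trans (+-cong h0≈0 (trans (-‿cong (zeroʳ _)) -0#≈0#)) (+-identityʳ _))
      (solve 1 (λ a → a :+ :- (a :* con (+ 1)) := con (+ 0)) refl h₁)
    h₁≈0 : h₁ ≈ 0#
    h₁≈0 = cancelʳ-zero fM≉0 (begin
      h₁ * f (+ M) s                   ≈⟨ solve 2 (λ a b → b := :- (a :+ :- b) :+ a) refl (h (+ M)) (h₁ * f (+ M) s) ⟩
      - d (+ M) + h (+ M)              ≈⟨ +-cong (-‿cong (d≈0 (+ M))) hM≈0 ⟩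
      - 0# + 0#                        ≈⟨ +-identityʳ _ ⟩
      - 0#                             ≈⟨ -0#≈0# ⟩
      0#                               ∎)

  -- The Casoratian

  casoratiFactor : Carrier → ℕ → Carrier
  casoratiFactor s M = pow (- 1#) M * (pow s M * pow q (triangular M))

  casoratian : (ℤ → Carrier) → (ℤ → Carrier) → ℤ → Carrier
  casoratian u w m = u (ℤ.suc m) * w m - u m * w (ℤ.suc m)

  casoratian-suc : ∀ {s u w} → IsSolution s u → IsSolution s w → ∀ m →
    casoratian u w (ℤ.suc m) ≈ - (powℤ q m * s) * casoratian u w m
  casoratian-suc {s} {u} {w} solu solw m = begin
    u (ℤ.suc (ℤ.suc m)) * w₁ - u₁ * w (ℤ.suc (ℤ.suc m))  ≈⟨ +-cong (*-cong (solu m) refl) (-‿cong (*-cong refl (solw m))) ⟩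
    (x * u₁ + r * u₀) * w₁ - u₁ * (x * w₁ + r * w₀)
      ≈⟨ solve 6 (λ x r u₀ u₁ w₀ w₁ → (x :* u₁ :+ r :* u₀) :* w₁ :+ :- (u₁ :* (x :* w₁ :+ r :* w₀))
                                      := (:- r) :* (u₁ :* w₀ :+ :- (u₀ :* w₁))) refl x r u₀ u₁ w₀ w₁ ⟩
    - r * (u₁ * w₀ - u₀ * w₁)                              ∎
    where
    r = powℤ q m * s
    u₀ = u m
    u₁ = u (ℤ.suc m)
    w₀ = w m
    w₁ = w (ℤ.suc m)

  casoratian-iterate : ∀ {s u w} → IsSolution s u → IsSolution s w → ∀ M →
    casoratian u w (+ M) ≈ casoratiFactor s M * casoratian u w (+ 0)
  casoratian-iterate {s} {u} {w} solu solw zero =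
    solve 1 (λ c → c := (con (+ 1) :* (con (+ 1) :* con (+ 1))) :* c) refl (casoratian u w (+ 0))
  casoratian-iterate {s} {u} {w} solu solw (suc M) = begin
    C (+ suc M)                                       ≈⟨ casoratian-suc solu solw (+ M) ⟩
    - (pow q M * s) * C (+ M)                         ≈⟨ *-cong refl (casoratian-iterate solu solw M) ⟩
    - (pow q M * s) * (casoratiFactor s M * C (+ 0))
      ≈⟨ solve 6 (λ a s e S Q c → (:- (a :* s)) :* ((e :* (S :* Q)) :* c) := ((:- con (+ 1)) :* e) :* ((s :* S) :* (Q :* a)) :* c)
           refl (pow q M) s (pow (- 1#) M) (pow s M) (pow q (triangular M)) (C (+ 0)) ⟩
    (- 1# * pow (- 1#) M) * ((s * pow s M) * (pow q (triangular M) * pow q M)) * C (+ 0)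
      ≈⟨ *-cong (*-cong refl (*-cong refl (pow-+ q (triangular M) M))) refl ⟨
    casoratiFactor s (suc M) * C (+ 0)                ∎
    where C = casoratian u w

  fib-casoratian : ∀ {s} → s ≉ 0# → ∀ M → - f (+ M) s ≈ casoratiFactor s M * shiftedFib s M (+ 0)
  fib-casoratian {s} s≉0 M = begin
    - f (+ M) s                                  ≈⟨ at-M ⟨
    C (+ M)                                      ≈⟨ casoratian-iterate (fib-isSolution s≉0) (shiftedFib-isSolution s≉0 M) M ⟩
    casoratiFactor s M * C (+ 0)                 ≈⟨ *-cong refl at-0 ⟩
    casoratiFactor s M * shiftedFib s M (+ 0)    ∎
    where
    C = casoratian (λ n → f n s) (shiftedFib s M)
    t = pow q M * s
    g-1+M≈1 : shiftedFib s M (+ suc M) ≈ 1#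
    g-1+M≈1 = reflexive (≡.cong (λ z → f z t) (≡.trans (suc-minus (+ M) (+ M)) (≡.cong ℤ.suc (ℤP.+-inverseʳ (+ M)))))
    at-M : C (+ M) ≈ - f (+ M) s
    at-M = begin
      f (+ suc M) s * shiftedFib s M (+ M) - f (+ M) s * shiftedFib s M (+ suc M)
        ≈⟨ +-cong (*-cong refl (shiftedFib-self s M)) (-‿cong (*-cong refl g-1+M≈1)) ⟩
      f (+ suc M) s * 0# - f (+ M) s * 1#
        ≈⟨ solve 2 (λ a b → a :* con (+ 0) :+ :- (b :* con (+ 1)) := :- b) refl (f (+ suc M) s) (f (+ M) s) ⟩
      - f (+ M) s ∎
    at-0 : C (+ 0) ≈ shiftedFib s M (+ 0)
    at-0 = solve 2 (λ g₀ g₁ → con (+ 1) :* g₀ :+ :- (con (+ 0) :* g₁) := g₀) refl (shiftedFib s M (+ 0)) (shiftedFib s M (+ 1))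

  weight : Carrier → ℕ → Carrier
  weight s j = pow (- 1#) (choose2 q x s (suc j)) * pow s (choose2 q x s j)
               * pow q ((j ℕ.* (j ∸ 1) ℕ.* ((2 ℕ.* j) ∸ 1)) ℕ./ 6)

  weight≈ : ∀ s j → weight s j ≈ pow (- 1#) (triangular (suc j)) * pow s (triangular j) * pow q (sumOfSquares j)
  weight≈ s j = *-cong (*-cong (pow-≡ (- 1#) (m*[m∸1]/2≡triangular (suc j))) (pow-≡ s (m*[m∸1]/2≡triangular j)))
                       (pow-≡ q (pyramidal/6≡sumOfSquares j))

  weight-suc : ∀ s j → s * weight s (suc j) ≈ weight (q * s) j * casoratiFactor s (suc j)
  weight-suc s j = begin
    s * weight s (suc j)
      ≈⟨ *-cong refl (weight≈ s (suc j)) ⟩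
    s * (pow (- 1#) (triangular (suc j) ℕ.+ suc j) * pow s (triangular j ℕ.+ j) * pow q (sumOfSquares j ℕ.+ j ℕ.* j))
      ≈⟨ *-cong refl (*-cong (*-cong (pow-+ (- 1#) (triangular (suc j)) (suc j)) (pow-+ s (triangular j) j))
                             (trans (pow-+ q (sumOfSquares j) (j ℕ.* j))
                                    (*-cong refl (trans (pow-≡ q (m*m≡triangular+triangular[1+m] j)) (pow-+ q (triangular j) (triangular (suc j))))))) ⟩
    s * ((A * B) * (C * D) * (E * (G * H)))
      ≈⟨ solve 8 (λ s A B C D E G H → s :* ((A :* B) :* (C :* D) :* (E :* (G :* H))) := (A :* (G :* C) :* E) :* (B :* ((s :* D) :* H)))
           refl s A B C D E G H ⟩
    (A * (G * C) * E) * (B * ((s * D) * H))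
      ≈⟨ *-cong (*-cong (*-cong refl (pow-distrib-* q s (triangular j))) refl) refl ⟨
    (A * pow (q * s) (triangular j) * E) * casoratiFactor s (suc j)
      ≈⟨ *-cong (weight≈ (q * s) j) refl ⟨
    weight (q * s) j * casoratiFactor s (suc j) ∎
    where
    A = pow (- 1#) (triangular (suc j))
    B = pow (- 1#) (suc j)
    C = pow s (triangular j)
    D = pow s j
    E = pow q (sumOfSquares j)
    G = pow q (triangular j)
    H = pow q (triangular (suc j))

  casoratiFactor-nonzero : ∀ {s} → s ≉ 0# → ∀ M → casoratiFactor s M ≉ 0#
  casoratiFactor-nonzero s≉0 M = *-nonzero (pow-nonzero M -1≉0) (*-nonzero (pow-nonzero M s≉0) (pow-nonzero (triangular M) q≉0))

  prod-cong : ∀ m {G G' : ℕ → Carrier} → (∀ i → 1 ≤ i → i ≤ m → G i ≈ G' i) → prod q x m G ≈ prod q x m G'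
  prod-cong zero    G≈G' = refl
  prod-cong (suc m) G≈G' = *-cong (prod-cong m (λ i 1≤i i≤m → G≈G' i 1≤i (ℕP.m≤n⇒m≤1+n i≤m))) (G≈G' (suc m) (s≤s z≤n) ℕP.≤-refl)

  prod-nonzero : ∀ m (G : ℕ → Carrier) → (∀ i → 1 ≤ i → i ≤ m → G i ≉ 0#) → prod q x m G ≉ 0#
  prod-nonzero zero    G G≉0 = 1≉0
  prod-nonzero (suc m) G G≉0 = *-nonzero (prod-nonzero m G (λ i 1≤i i≤m → G≉0 i 1≤i (ℕP.m≤n⇒m≤1+n i≤m))) (G≉0 (suc m) (s≤s z≤n) ℕP.≤-refl)

  prod≈0 : ∀ m (G : ℕ → Carrier) i → 1 ≤ i → i ≤ m → G i ≈ 0# → prod q x m G ≈ 0#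
  prod≈0 zero    G .0 () z≤n Gi≈0
  prod≈0 (suc m) G i 1≤i i≤1+m Gi≈0 with ℕP.m≤n⇒m<n∨m≡n i≤1+m
  ... | inj₁ (s≤s i≤m) = trans (*-cong (prod≈0 m G i 1≤i i≤m Gi≈0) refl) (zeroˡ _)
  ... | inj₂ ≡.refl    = trans (*-cong refl Gi≈0) (zeroʳ _)

  sumTo-cong : ∀ N {G G' : ℕ → Carrier} → (∀ j → j ≤ N → G j ≈ G' j) → sumTo q x N G ≈ sumTo q x N G'
  sumTo-cong zero    G≈G' = G≈G' 0 z≤n
  sumTo-cong (suc N) G≈G' = +-cong (sumTo-cong N (λ j j≤N → G≈G' j (ℕP.m≤n⇒m≤1+n j≤N))) (G≈G' (suc N) ℕP.≤-refl)

  *-distribˡ-sumTo : ∀ N a (G : ℕ → Carrier) → a * sumTo q x N G ≈ sumTo q x N (λ j → a * G j)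
  *-distribˡ-sumTo zero    a G = refl
  *-distribˡ-sumTo (suc N) a G = trans (distribˡ a _ _) (+-cong (*-distribˡ-sumTo N a G) refl)

  sumTo-suc : ∀ N (G : ℕ → Carrier) → sumTo q x (suc N) G ≈ G 0 + sumTo q x N (λ j → G (suc j))
  sumTo-suc zero    G = refl
  sumTo-suc (suc N) G = trans (+-cong (sumTo-suc N G) refl) (+-assoc _ _ _)

  -- Nonvanishing of the factors of the denominators

  Nondegenerate : Carrier → ℕ → Set ℓ
  Nondegenerate s K = ∀ i b → 1 ≤ i → i ℕ.+ b ≤ K → f (+ i) (pow q b * s) ≉ 0#

  nondegenerate-weaken : ∀ {s K K'} → K' ≤ K → Nondegenerate s K → Nondegenerate s K'
  nondegenerate-weaken K'≤K nd i b 1≤i i+b≤K' = nd i b 1≤i (ℕP.≤-trans i+b≤K' K'≤K)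

  nondegenerate-shift : ∀ {s} → s ≉ 0# → ∀ K → Nondegenerate s (suc K) → Nondegenerate (q * s) K
  nondegenerate-shift {s} s≉0 K nd i b 1≤i i+b≤K fi≈0 =
    nd i (suc b) 1≤i (ℕP.≤-trans (ℕP.≤-reflexive (ℕP.+-suc i b)) (s≤s i+b≤K))
       (trans (fib-cong (q^b*s≉0 (suc b) s≉0) (q^[1+b]*s≈q^b*[q*s] b s) (+ i)) fi≈0)

  nondegenerate⇒fib≉0 : ∀ {s K} → s ≉ 0# → Nondegenerate s K → ∀ i → 1 ≤ i → i ≤ K → f (+ i) s ≉ 0#
  nondegenerate⇒fib≉0 {s} s≉0 nd i 1≤i i≤K fi≈0 =
    nd i 0 1≤i (ℕP.≤-trans (ℕP.≤-reflexive (ℕP.+-identityʳ i)) i≤K)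
       (trans (fib-cong (q^b*s≉0 0 s≉0) (*-identityˡ s) (+ i)) fi≈0)

  nondegenerate⇒num≉0 : ∀ {s K} → s ≉ 0# → Nondegenerate s K → num q x s K ≉ 0#
  nondegenerate⇒num≉0 {s} {K} s≉0 nd = prod-nonzero K _ (nondegenerate⇒fib≉0 s≉0 nd)

  nondegenerate⇒den≉0 : ∀ {s K} j → j ≤ K → Nondegenerate s K → den q x s K j ≉ 0#
  nondegenerate⇒den≉0 {s} {K} j j≤K nd = *-nonzero
    (prod-nonzero j _ (λ i 1≤i i≤j → nd i (j ∸ i) 1≤i (ℕP.≤-trans (ℕP.≤-reflexive (ℕP.m+[n∸m]≡n i≤j)) j≤K)))
    (prod-nonzero (K ∸ j) _ (λ i 1≤i i≤K∸j → nd i j 1≤i (ℕP.≤-trans (ℕP.+-monoˡ-≤ j i≤K∸j) (ℕP.≤-reflexive (ℕP.m∸n+n≡m j≤K)))))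

  den≉0⇒nondegenerate : ∀ {s} K → (∀ j → j ≤ K → den q x s K j ≉ 0#) → Nondegenerate s K
  den≉0⇒nondegenerate {s} K den≉0 i b 1≤i i+b≤K fi≈0 = den≉0 b (ℕP.m+n≤o⇒n≤o i i+b≤K)
    (trans (*-cong refl (prod≈0 (K ∸ b) (λ i → f (+ i) (pow q b * s)) i 1≤i i≤K∸b fi≈0)) (zeroʳ _))
    where
    i≤K∸b : i ≤ K ∸ b
    i≤K∸b = ℕP.≤-trans (ℕP.≤-reflexive (≡.sym (ℕP.m+n∸n≡m i b))) (ℕP.∸-monoˡ-≤ b i+b≤K)

  den-suc : ∀ s K j → j ≤ K → den q x s (suc K) j ≈ den q x s K j * f (+ suc (K ∸ j)) (pow q j * s)
  den-suc s K j j≤K = begin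
    A * prod q x (suc K ∸ j) B              ≡⟨ ≡.cong (λ n → A * prod q x n B) (ℕP.+-∸-assoc 1 j≤K) ⟩
    A * (prod q x (K ∸ j) B * B (suc (K ∸ j))) ≈⟨ *-assoc _ _ _ ⟨
    den q x s K j * B (suc (K ∸ j))         ∎
    where
    A = prod q x j (λ i → f (+ i) (pow q (j ∸ i) * s))
    B : ℕ → Carrier
    B i = f (+ i) (pow q j * s)

  den-shift : ∀ {s} → s ≉ 0# → ∀ K j → den q x s (suc K) (suc j) ≈ den q x (q * s) K j * f (+ suc j) s
  den-shift {s} s≉0 K j = begin
    (prod q x j A * A (suc j)) * prod q x (K ∸ j) B
      ≈⟨ *-cong (*-cong (prod-cong j A≈A') A-top) (prod-cong (K ∸ j) (λ i _ _ → shift (+ i) j)) ⟩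
    (prod q x j A' * f (+ suc j) s) * prod q x (K ∸ j) B'
      ≈⟨ solve 3 (λ a b c → (a :* b) :* c := (a :* c) :* b) refl (prod q x j A') (f (+ suc j) s) (prod q x (K ∸ j) B') ⟩
    den q x (q * s) K j * f (+ suc j) s ∎
    where
    A A' B B' : ℕ → Carrier
    A i = f (+ i) (pow q (suc j ∸ i) * s)
    A' i = f (+ i) (pow q (j ∸ i) * (q * s))
    B i = f (+ i) (pow q (suc j) * s)
    B' i = f (+ i) (pow q j * (q * s))
    shift : ∀ n b → f n (pow q (suc b) * s) ≈ f n (pow q b * (q * s))
    shift n b = fib-cong (q^b*s≉0 (suc b) s≉0) (q^[1+b]*s≈q^b*[q*s] b s) n
    A≈A' : ∀ i → 1 ≤ i → i ≤ j → A i ≈ A' i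
    A≈A' i _ i≤j = trans (reflexive (≡.cong (λ n → f (+ i) (pow q n * s)) (ℕP.+-∸-assoc 1 i≤j))) (shift (+ i) (j ∸ i))
    A-top : A (suc j) ≈ f (+ suc j) s
    A-top = fib-cong (q^b*s≉0 (j ∸ j) s≉0) (trans (*-cong (pow-≡ q (ℕP.n∸n≡0 j)) refl) (*-identityˡ s)) (+ suc j)

  bracket-suc : ∀ {s} K j → j ≤ K → den q x s K j ≉ 0# → f (+ suc (K ∸ j)) (pow q j * s) ≉ 0# →
    bracket q x s (suc K) j * f (+ suc (K ∸ j)) (pow q j * s) ≈ f (+ suc K) s * bracket q x s K j
  bracket-suc {s} K j j≤K d≉0 φ≉0 = begin
    (num q x s K * fK) * den q x s (suc K) j ⁻¹ * φ
      ≈⟨ *-cong (*-cong refl (trans (⁻¹-cong d'≉0 (den-suc s K j j≤K)) (⁻¹-distrib-* d≉0 φ≉0))) refl ⟩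
    (num q x s K * fK) * (den q x s K j ⁻¹ * φ ⁻¹) * φ
      ≈⟨ solve 5 (λ n fK d φ' φ → (n :* fK) :* (d :* φ') :* φ := (fK :* (n :* d)) :* (φ' :* φ))
           refl (num q x s K) fK (den q x s K j ⁻¹) (φ ⁻¹) φ ⟩
    (fK * bracket q x s K j) * (φ ⁻¹ * φ)    ≈⟨ *-cong refl (inverseˡ φ≉0) ⟩
    (fK * bracket q x s K j) * 1#            ≈⟨ *-identityʳ _ ⟩
    fK * bracket q x s K j                   ∎
    where
    φ = f (+ suc (K ∸ j)) (pow q j * s)
    fK = f (+ suc K) s
    d'≉0 : den q x s (suc K) j ≉ 0#
    d'≉0 d'≈0 = *-nonzero d≉0 φ≉0 (trans (sym (den-suc s K j j≤K)) d'≈0)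

  bracket-shift : ∀ {s} → s ≉ 0# → ∀ K j → den q x (q * s) K j ≉ 0# → f (+ suc j) s ≉ 0# →
    bracket q x s (suc K) (suc j) ≈ num q x s (suc K) * (den q x (q * s) K j ⁻¹ * f (+ suc j) s ⁻¹)
  bracket-shift s≉0 K j d≉0 F≉0 = *-cong refl (trans (⁻¹-cong d'≉0 (den-shift s≉0 K j)) (⁻¹-distrib-* d≉0 F≉0))
    where d'≉0 = λ d'≈0 → *-nonzero d≉0 F≉0 (trans (sym (den-shift s≉0 K j)) d'≈0)

  -- The multilinear form

  coefficient : Carrier → ℕ → ℕ → Carrier
  coefficient s k j = weight s j * bracket q x s (suc k) j

  monomial : Carrier → ℕ → ∀ {n} → Vec ℤ n → Carrier
  monomial s j []       = 1#
  monomial s j (m ∷ ns) = shiftedFib s j m * monomial s j ns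

  multilinear : Carrier → (k : ℕ) → Vec ℤ k → Carrier
  multilinear s k ns = sumTo q x (suc k) (λ j → coefficient s k j * monomial s j ns)

  monomial-shift : ∀ {s} → s ≉ 0# → ∀ j {n} (ns : Vec ℤ n) → monomial s (suc j) ns ≈ monomial (q * s) j (Vec.map ℤ.pred ns)
  monomial-shift s≉0 j []                = refl
  monomial-shift {s} s≉0 j (m ∷ ns) = *-cong (begin
    f (m ℤ.- + suc j) (pow q (suc j) * s)             ≡⟨ ≡.cong (λ z → f z (pow q (suc j) * s)) index ⟩
    f (ℤ.pred m ℤ.- + j) (pow q (suc j) * s)          ≈⟨ fib-cong (q^b*s≉0 (suc j) s≉0) (q^[1+b]*s≈q^b*[q*s] j s) (ℤ.pred m ℤ.- + j) ⟩
    f (ℤ.pred m ℤ.- + j) (pow q j * (q * s))          ∎) (monomial-shift s≉0 j ns)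
    where
    index : m ℤ.- + suc j ≡ ℤ.pred m ℤ.- + j
    index = ≡.trans (ℤP.minus-suc m j) (≡.sym (ℤP.+-assoc -[1+ 0 ] m (ℤ.- + j)))

  coefficient-top : ∀ {s} k → Nondegenerate s (suc (suc k)) → ∀ j → j ≤ suc k →
    coefficient s (suc k) j * shiftedFib s j (+ suc (suc k)) ≈ f (+ suc (suc k)) s * coefficient s k j
  coefficient-top {s} k nd j j≤1+k = begin
    coefficient s (suc k) j * shiftedFib s j (+ suc (suc k))         ≡⟨ ≡.cong (coefficient s (suc k) j *_) index ⟩
    (weight s j * bracket q x s (suc (suc k)) j) * φ                 ≈⟨ *-assoc _ _ _ ⟩
    weight s j * (bracket q x s (suc (suc k)) j * φ)                 ≈⟨ *-cong refl (bracket-suc (suc k) j j≤1+k d≉0 φ≉0) ⟩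
    weight s j * (f (+ suc (suc k)) s * bracket q x s (suc k) j)
      ≈⟨ solve 3 (λ a b c → a :* (b :* c) := b :* (a :* c)) refl (weight s j) (f (+ suc (suc k)) s) (bracket q x s (suc k) j) ⟩
    f (+ suc (suc k)) s * coefficient s k j                          ∎
    where
    φ = f (+ suc (suc k ∸ j)) (pow q j * s)
    index : shiftedFib s j (+ suc (suc k)) ≡ φ
    index = ≡.cong (λ z → f z (pow q j * s))
      (≡.trans (ℤP.m-n≡m⊖n (suc (suc k)) j) (≡.trans (ℤP.⊖-≥ (ℕP.m≤n⇒m≤1+n j≤1+k)) (≡.cong +_ (ℕP.+-∸-assoc 1 j≤1+k))))
    φ≉0 : φ ≉ 0#
    φ≉0 = nd (suc (suc k ∸ j)) j (s≤s z≤n) (ℕP.≤-reflexive (≡.cong suc (ℕP.m∸n+n≡m j≤1+k)))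
    d≉0 : den q x s (suc k) j ≉ 0#
    d≉0 = nondegenerate⇒den≉0 j j≤1+k (nondegenerate-weaken (ℕP.n≤1+n _) nd)

  -- The Casoratian identity for f(-(j+1), x, q^(j+1) s) and weight-suc make the factors
  -- casoratiFactor s (j+1) cancel.
  coefficient-bottom : ∀ {s} → s ≉ 0# → ∀ k → Nondegenerate s (suc (suc k)) → ∀ j → j ≤ suc k →
    (s * num q x (q * s) (suc k)) * (coefficient s (suc k) (suc j) * shiftedFib s (suc j) (+ 0))
      ≈ - num q x s (suc (suc k)) * coefficient (q * s) k j
  coefficient-bottom {s} s≉0 k nd j j≤1+k = *-cancelʳ (casoratiFactor-nonzero s≉0 (suc j)) (begin
    ((s * nq) * ((w₁ * bracket q x s (suc (suc k)) (suc j)) * N)) * X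
      ≈⟨ *-cong (*-cong refl (*-cong (*-cong refl (bracket-shift s≉0 (suc k) j d≉0 φ≉0)) refl)) refl ⟩
    ((s * nq) * ((w₁ * (n₂ * (d ⁻¹ * φ ⁻¹))) * N)) * X
      ≈⟨ solve 8 (λ s nq w₁ n₂ d' φ' N X → ((s :* nq) :* ((w₁ :* (n₂ :* (d' :* φ'))) :* N)) :* X
                   := (((s :* w₁) :* (nq :* d')) :* n₂) :* (φ' :* (X :* N))) refl s nq w₁ n₂ (d ⁻¹) (φ ⁻¹) N X ⟩
    (((s * w₁) * B) * n₂) * (φ ⁻¹ * (X * N))
      ≈⟨ *-cong (*-cong (*-cong (weight-suc s j) refl) refl) (*-cong refl (sym (fib-casoratian s≉0 (suc j)))) ⟩
    (((w₀ * X) * B) * n₂) * (φ ⁻¹ * - φ)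
      ≈⟨ *-cong refl (trans (sym (-‿distribʳ-* _ _)) (-‿cong (inverseˡ φ≉0))) ⟩
    (((w₀ * X) * B) * n₂) * - 1#
      ≈⟨ solve 4 (λ w₀ X B n₂ → (((w₀ :* X) :* B) :* n₂) :* (:- con (+ 1)) := ((:- n₂) :* (w₀ :* B)) :* X) refl w₀ X B n₂ ⟩
    (- n₂ * coefficient (q * s) k j) * X ∎)
    where
    nq = num q x (q * s) (suc k)
    n₂ = num q x s (suc (suc k))
    d = den q x (q * s) (suc k) j
    φ = f (+ suc j) s
    w₀ = weight (q * s) j
    w₁ = weight s (suc j)
    B = bracket q x (q * s) (suc k) j
    N = shiftedFib s (suc j) (+ 0)
    X = casoratiFactor s (suc j)
    d≉0 : d ≉ 0#
    d≉0 = nondegenerate⇒den≉0 j j≤1+k (nondegenerate-shift s≉0 (suc k) nd)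
    φ≉0 : φ ≉ 0#
    φ≉0 = nondegenerate⇒fib≉0 s≉0 nd (suc j) (s≤s z≤n) (s≤s j≤1+k)

  multilinear≈0 : ∀ k {s} → s ≉ 0# → Nondegenerate s (suc k) → (ns : Vec ℤ k) → multilinear s k ns ≈ 0#
  multilinear≈0 zero {s} _ _ [] = begin
    multilinear s 0 []
      ≈⟨ solve 2 (λ u v → (((con (+ 1) :* con (+ 1)) :* con (+ 1)) :* ((con (+ 1) :* con (+ 1)) :* u)) :* con (+ 1)
                          :+ ((((:- con (+ 1)) :* con (+ 1)) :* con (+ 1)) :* con (+ 1)) :* ((con (+ 1) :* con (+ 1)) :* v) :* con (+ 1)
                          := u :+ :- v) refl u v ⟩
    u - v         ≈⟨ +-cong (⁻¹-cong (*-nonzero 1≉0 (*-nonzero 1≉0 1≉0)) (sym (*-assoc 1# 1# 1#))) refl ⟩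
    v - v         ≈⟨ -‿inverseʳ v ⟩
    0#            ∎
    where
    u = (1# * (1# * 1#)) ⁻¹
    v = ((1# * 1#) * 1#) ⁻¹
  multilinear≈0 (suc k) {s} s≉0 nd (m ∷ ns) =
    solution≈0-of-boundary s≉0 h-isSolution h[0]≈0 (suc (suc k)) h[2+k]≈0 f[2+k]≉0 m
    where
    G : ℕ → ℤ → Carrier
    G j n = coefficient s (suc k) j * (shiftedFib s j n * monomial s j ns)
    h : ℤ → Carrier
    h n = sumTo q x (suc (suc k)) (λ j → G j n)
    h-isSolution : IsSolution s h
    h-isSolution = isSolution-sumTo (suc (suc k)) G (λ j →
      isSolution-*ˡ (coefficient s (suc k) j) (isSolution-*ʳ (monomial s j ns) (shiftedFib-isSolution s≉0 j)))

    f[2+k] = f (+ suc (suc k)) s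
    f[2+k]≉0 : f[2+k] ≉ 0#
    f[2+k]≉0 = nondegenerate⇒fib≉0 s≉0 nd (suc (suc k)) (s≤s z≤n) ℕP.≤-refl
    h[2+k]≈0 : h (+ suc (suc k)) ≈ 0#
    h[2+k]≈0 = begin
      sumTo q x (suc k) (λ j → G j (+ suc (suc k))) + G (suc (suc k)) (+ suc (suc k))
        ≈⟨ +-cong (sumTo-cong (suc k) top) last≈0 ⟩
      sumTo q x (suc k) (λ j → f[2+k] * (coefficient s k j * monomial s j ns)) + 0#
        ≈⟨ +-identityʳ _ ⟩
      sumTo q x (suc k) (λ j → f[2+k] * (coefficient s k j * monomial s j ns))
        ≈⟨ *-distribˡ-sumTo (suc k) f[2+k] _ ⟨
      f[2+k] * multilinear s k ns
        ≈⟨ *-cong refl (multilinear≈0 k s≉0 (nondegenerate-weaken (ℕP.n≤1+n _) nd) ns) ⟩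
      f[2+k] * 0#  ≈⟨ zeroʳ _ ⟩
      0#           ∎
      where
      top : ∀ j → j ≤ suc k → G j (+ suc (suc k)) ≈ f[2+k] * (coefficient s k j * monomial s j ns)
      top j j≤1+k = begin
        coefficient s (suc k) j * (shiftedFib s j (+ suc (suc k)) * monomial s j ns)  ≈⟨ *-assoc _ _ _ ⟨
        (coefficient s (suc k) j * shiftedFib s j (+ suc (suc k))) * monomial s j ns  ≈⟨ *-cong (coefficient-top k nd j j≤1+k) refl ⟩
        (f[2+k] * coefficient s k j) * monomial s j ns                                ≈⟨ *-assoc _ _ _ ⟩
        f[2+k] * (coefficient s k j * monomial s j ns)                                ∎
      last≈0 : G (suc (suc k)) (+ suc (suc k)) ≈ 0#
      last≈0 = trans (*-cong refl (trans (*-cong (shiftedFib-self s (suc (suc k))) refl) (zeroˡ _))) (zeroʳ _)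

    n₂ = num q x s (suc (suc k))
    ns' = Vec.map ℤ.pred ns
    μ = s * num q x (q * s) (suc k)
    μ≉0 : μ ≉ 0#
    μ≉0 = *-nonzero s≉0 (nondegenerate⇒num≉0 (*-nonzero q≉0 s≉0) (nondegenerate-shift s≉0 (suc k) nd))
    μh[0]≈0 : μ * h (+ 0) ≈ 0#
    μh[0]≈0 = begin
      μ * h (+ 0)
        ≈⟨ *-cong refl (trans (sumTo-suc (suc k) (λ j → G j (+ 0))) (+-cong G[0,0]≈0 refl)) ⟩
      μ * (0# + sumTo q x (suc k) (λ j → G (suc j) (+ 0)))
        ≈⟨ trans (*-cong refl (+-identityˡ _)) (*-distribˡ-sumTo (suc k) μ _) ⟩
      sumTo q x (suc k) (λ j → μ * G (suc j) (+ 0))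
        ≈⟨ sumTo-cong (suc k) bottom ⟩
      sumTo q x (suc k) (λ j → - n₂ * (coefficient (q * s) k j * monomial (q * s) j ns'))
        ≈⟨ *-distribˡ-sumTo (suc k) (- n₂) _ ⟨
      - n₂ * multilinear (q * s) k ns'
        ≈⟨ *-cong refl (multilinear≈0 k (*-nonzero q≉0 s≉0) (nondegenerate-shift s≉0 (suc k) nd) ns') ⟩
      - n₂ * 0#    ≈⟨ zeroʳ _ ⟩
      0#           ∎
      where
      G[0,0]≈0 : G 0 (+ 0) ≈ 0#
      G[0,0]≈0 = trans (*-cong refl (zeroˡ _)) (zeroʳ _)
      bottom : ∀ j → j ≤ suc k → μ * G (suc j) (+ 0) ≈ - n₂ * (coefficient (q * s) k j * monomial (q * s) j ns')
      bottom j j≤1+k = begin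
        μ * (coefficient s (suc k) (suc j) * (N * monomial s (suc j) ns))
          ≈⟨ solve 4 (λ a b c d → a :* (b :* (c :* d)) := (a :* (b :* c)) :* d) refl μ (coefficient s (suc k) (suc j)) N (monomial s (suc j) ns) ⟩
        (μ * (coefficient s (suc k) (suc j) * N)) * monomial s (suc j) ns
          ≈⟨ *-cong (coefficient-bottom s≉0 k nd j j≤1+k) (monomial-shift s≉0 j ns) ⟩
        (- n₂ * coefficient (q * s) k j) * monomial (q * s) j ns'
          ≈⟨ *-assoc _ _ _ ⟩
        - n₂ * (coefficient (q * s) k j * monomial (q * s) j ns') ∎
        where N = shiftedFib s (suc j) (+ 0)
    h[0]≈0 : h (+ 0) ≈ 0#
    h[0]≈0 = cancelˡ-zero μ≉0 μh[0]≈0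

  pow-shiftedFib≡monomial : ∀ s j n k → pow (shiftedFib s j n) k ≡ monomial s j (Vec.replicate k n)
  pow-shiftedFib≡monomial s j n zero    = ≡.refl
  pow-shiftedFib≡monomial s j n (suc k) = ≡.cong (shiftedFib s j n *_) (pow-shiftedFib≡monomial s j n k)

  lhs≈multilinear : ∀ s k n → FieldDefs.lhs F q x s k n ≈ multilinear s k (Vec.replicate k n)
  lhs≈multilinear s k n = sumTo-cong (suc k) (λ j _ → reflexive (≡.cong (coefficient s k j *_) (pow-shiftedFib≡monomial s j n k)))

theorem1 : ∀ {c ℓ : Level} (F : Field c ℓ) (q x s : Field.Carrier F) →
    ¬ (Field._≈_ F q (Field.0# F)) →
    ¬ (Field._≈_ F s (Field.0# F)) →
    (k : ℕ) → 1 ≤ k →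
    (∀ j → j ≤ suc k → ¬ (Field._≈_ F (FieldDefs.den F q x s (suc k) j) (Field.0# F))) →
    (n : ℤ) →
    Field._≈_ F (FieldDefs.lhs F q x s k n) (Field.0# F)
-- The identity holds for k = 0 as well.
theorem1 F q x s q≉0 s≉0 k _ den≉0 n = Field.trans F
  (lhs≈multilinear s k n)
  (multilinear≈0 k s≉0 (den≉0⇒nondegenerate (suc k) den≉0) (Vec.replicate k n))
  where open CarlitzFibonacci F q x q≉0
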